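{- Let $n$ be a positive integer, $m \in \{2,3,\ldots,n-1\}$, and $R = \{2,3,\ldots,n-m\} \cup \{n\}$ (where $\{2,\ldots,n-m\}$ is empty if $n-m<2$). Then the restricted incomplete rotator graph $\mathrm{Rot}_n(R,m)$ is not strongly connected.
   Context: $\Pi_n$ is the set of strings $a_1 \cdots a_n$ that are permutations of $\{1,\ldots,n\}$. For $2 \le r \le n$, the prefix-rotation $\sigma_r$ maps $a_1 \cdots a_n$ to $a_2 \cdots a_r a_1 a_{r+1} \cdots a_n$. For $R \subseteq \{2,\ldots,n\}$ and $m \in \{1,\ldots,n\}$, $\mathrm{Rot}_n(R,m)$ is the directed graph whose nodes are the strings of $\Pi_n$ whose last symbol is at most $m$, with an arc from $\mathbf{a}$ to $\mathbf{b}$ whenever both are nodes and $\mathbf{b} = \mathbf{a}\sigma_r$ for some $r \in R$. -}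

module Defs where

open import Data.Nat using (ℕ; suc; _≤_; _∸_)
open import Data.List using (List; []; _∷_; _++_; take; drop; map; upTo; _∷ʳ_)
open import Data.List.Relation.Binary.Permutation.Propositional using (_↭_)
open import Data.Product using (Σ; ∃; _×_)
open import Data.Sum using (_⊎_)
open import Relation.Binary.PropositionalEquality using (_≡_)
open import Relation.Binary.Construct.Closure.ReflexiveTransitive using (Star)

InΠ : ℕ → List ℕ → Set
InΠ n a = a ↭ map suc (upTo n)

LastAtMost : ℕ → List ℕ → Set
LastAtMost m a = Σ (List ℕ) λ ys → Σ ℕ λ x → (a ≡ ys ∷ʳ x) × (x ≤ m)

-- prefix rotation σ_r : a1 ... an ↦ a2 ... ar a1 a(r+1) ... an
-- (only used for 2 ≤ r ≤ n)
σ : ℕ → List ℕ → List ℕ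
σ r []       = []
σ r (x ∷ xs) = take (r ∸ 1) xs ++ (x ∷ drop (r ∸ 1) xs)

Node : ℕ → ℕ → List ℕ → Set
Node n m a = InΠ n a × LastAtMost m a

Arc : ℕ → (ℕ → Set) → ℕ → List ℕ → List ℕ → Set
Arc n R m a b = Node n m a × Node n m b ×
  (Σ ℕ λ r → R r × 2 ≤ r × r ≤ n × (b ≡ σ r a))

StronglyConnected : ℕ → (ℕ → Set) → ℕ → Set
StronglyConnected n R m =
  ∀ a b → Node n m a → Node n m b → Star (Arc n R m) a b

Rprop2 : ℕ → ℕ → ℕ → Set
Rprop2 n m r = ((2 ≤ r) × (r ≤ n ∸ m)) ⊎ (r ≡ n)

-- Let k = n − m ≥ 1. Every rotation σ_r with r ≤ k only permutes the first k
-- symbols, and σ_n moves the first symbol to the end, so it is an arc only when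
-- that symbol is at most m. Hence "the first k symbols all exceed m" is
-- preserved along arcs: a node starting with m+1 … n cannot reach one starting
-- with 1.
module Submission where

open import Defs
open import Data.Nat using (ℕ; zero; suc; _+_; _∸_; _≤_; _<_; z≤n; s≤s)
open import Data.Nat.Properties using (≤-refl; m≤m+n; <⇒≱; m+[n∸m]≡n; m<n⇒0<n∸m; m≤n⇒m≤1+n)
open import Data.List using (List; []; _∷_; _++_; _∷ʳ_; [_]; take; drop; length; map; upTo; applyUpTo)
open import Data.List.Properties using (++-assoc; ∷ʳ-injectiveʳ; applyUpTo-∷ʳ; take-all; drop-all; length-map; length-upTo; length-applyUpTo; map-upTo)
open import Data.List.Relation.Unary.All using (All; _∷_)
open import Data.List.Relation.Unary.All.Properties using (applyUpTo⁺₂)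
open import Data.List.Relation.Binary.Permutation.Propositional using (_↭_; ↭-refl; ↭-sym; ↭-trans; ↭-swap; ↭-prep; module PermutationReasoning)
open import Data.List.Relation.Binary.Permutation.Propositional.Properties using (All-resp-↭; ↭-length; ++-comm; shift; ++⁺ʳ)
open import Data.Product using (_,_)
open import Data.Sum using (inj₁; inj₂)
open import Data.Empty using (⊥-elim)
open import Function using (_∘_)
open import Relation.Nullary using (¬_)
open import Relation.Binary.PropositionalEquality using (_≡_; refl; sym; trans; cong; cong₂; subst; module ≡-Reasoning)
open import Relation.Binary.Construct.Closure.ReflexiveTransitive as Star using (Star)

take-length-++ : ∀ {A : Set} (xs ys : List A) → take (length xs) (xs ++ ys) ≡ xs
take-length-++ []       ys = refl
take-length-++ (x ∷ xs) ys = cong (x ∷_) (take-length-++ xs ys)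

applyUpTo-+ : ∀ {A : Set} (f : ℕ → A) m k →
  applyUpTo f (m + k) ≡ applyUpTo f m ++ applyUpTo (λ i → f (m + i)) k
applyUpTo-+ f zero    k = refl
applyUpTo-+ f (suc m) k = cong (f 0 ∷_) (applyUpTo-+ (f ∘ suc) m k)

take-insert-↭ : ∀ {A : Set} {j k} x (xs : List A) → j < k →
  take k (take j xs ++ x ∷ drop j xs) ↭ take k (x ∷ xs)
take-insert-↭ {j = zero}  x xs       _           = ↭-refl
take-insert-↭ {j = suc j} x []       _           = ↭-refl
take-insert-↭ {j = suc j} {suc (suc k)} x (y ∷ ys) (s≤s j<k) =
  ↭-trans (↭-prep y (take-insert-↭ x ys j<k)) (↭-swap y x ↭-refl)

take-σ-↭ : ∀ {r k} (xs : List ℕ) → r ≤ k → take k (σ r xs) ↭ take k xs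
take-σ-↭         []       _   = ↭-refl
take-σ-↭ {zero}  (x ∷ xs) _   = ↭-refl
take-σ-↭ {suc r} (x ∷ xs) r≤k = take-insert-↭ x xs r≤k

σ-full : ∀ x (xs : List ℕ) → σ (suc (length xs)) (x ∷ xs) ≡ xs ∷ʳ x
σ-full x xs = cong₂ (λ ys zs → ys ++ x ∷ zs)
  (take-all (length xs) xs ≤-refl) (drop-all (length xs) xs ≤-refl)

length-Π : ∀ {n a} → InΠ n a → length a ≡ n
length-Π {n} π = trans (↭-length π) (trans (length-map suc (upTo n)) (length-upTo n))

last-≤ : ∀ {m x} (xs : List ℕ) → LastAtMost m (xs ∷ʳ x) → x ≤ m
last-≤ xs (ys , y , eq , y≤m) = subst (_≤ _) (sym (∷ʳ-injectiveʳ xs ys eq)) y≤m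

σ-n-arc⇒head-≤ : ∀ {n m x xs} → InΠ n (x ∷ xs) → LastAtMost m (σ n (x ∷ xs)) → x ≤ m
σ-n-arc⇒head-≤ {m = m} {x} {xs} π last = last-≤ xs (subst (LastAtMost m) (σ-full x xs)
  (subst (λ r → LastAtMost m (σ r (x ∷ xs))) (sym (length-Π π)) last))

PrefixAbove : ℕ → ℕ → List ℕ → Set
PrefixAbove m k a = All (m <_) (take k a)

head-above : ∀ {m k x xs} → 1 ≤ k → PrefixAbove m k (x ∷ xs) → m < x
head-above {k = suc k} _ (m<x ∷ _) = m<x

arc-preserves-PrefixAbove : ∀ {n m a b} → 1 ≤ n ∸ m → Arc n (Rprop2 n m) m a b →
  PrefixAbove m (n ∸ m) a → PrefixAbove m (n ∸ m) b
arc-preserves-PrefixAbove _ (_ , _ , _ , inj₁ (_ , r≤k) , _ , _ , refl) above =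
  All-resp-↭ (↭-sym (take-σ-↭ _ r≤k)) above
arc-preserves-PrefixAbove {a = []} _ (_ , _ , _ , inj₂ refl , _ , _ , refl) above = above
arc-preserves-PrefixAbove {a = x ∷ xs} k≥1 ((π , _) , (_ , last) , _ , inj₂ refl , _ , _ , refl) above =
  ⊥-elim (<⇒≱ (head-above k≥1 above) (σ-n-arc⇒head-≤ π last))

reachable-preserves-PrefixAbove : ∀ {n m a b} → 1 ≤ n ∸ m → Star (Arc n (Rprop2 n m) m) a b →
  PrefixAbove m (n ∸ m) a → PrefixAbove m (n ∸ m) b
reachable-preserves-PrefixAbove k≥1 =
  Star.fold (λ a b → PrefixAbove _ _ a → PrefixAbove _ _ b)
    (λ arc rest → rest ∘ arc-preserves-PrefixAbove k≥1 arc) (λ above → above)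

PrefixAbove-++ : ∀ {m} (xs ys : List ℕ) → All (m <_) xs → PrefixAbove m (length xs) (xs ++ ys)
PrefixAbove-++ {m} xs ys above = subst (All (m <_)) (sym (take-length-++ xs ys)) above

module Witnesses (m' k : ℕ) where

  m : ℕ
  m = 2 + m'

  -- 1 ∷ middle ∷ʳ m lists the symbols 1 … m, and high lists m+1 … m+k.
  high middle : List ℕ
  high   = applyUpTo (λ i → suc (m + i)) k
  middle = applyUpTo (2 +_) m'

  high-first low-first : List ℕ
  high-first = (high ++ 1 ∷ middle) ∷ʳ m
  low-first  = (1 ∷ high ++ middle) ∷ʳ m

  Π-split : map suc (upTo (m + k)) ≡ ((1 ∷ middle) ∷ʳ m) ++ high
  Π-split = begin
    map suc (upTo (m + k))             ≡⟨ map-upTo suc (m + k) ⟩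
    applyUpTo suc (m + k)              ≡⟨ applyUpTo-+ suc m k ⟩
    applyUpTo suc m ++ high            ≡⟨ cong (_++ high) (applyUpTo-∷ʳ suc (suc m')) ⟨
    ((1 ∷ middle) ∷ʳ m) ++ high        ∎
    where open ≡-Reasoning

  high-first-↭ : high-first ↭ map suc (upTo (m + k))
  high-first-↭ = begin
    (high ++ 1 ∷ middle) ∷ʳ m          ≡⟨ ++-assoc high (1 ∷ middle) [ m ] ⟩
    high ++ ((1 ∷ middle) ∷ʳ m)        ↭⟨ ++-comm high ((1 ∷ middle) ∷ʳ m) ⟩
    ((1 ∷ middle) ∷ʳ m) ++ high        ≡⟨ Π-split ⟨
    map suc (upTo (m + k))             ∎
    where open PermutationReasoning

  low-first-↭ : low-first ↭ map suc (upTo (m + k))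
  low-first-↭ = ↭-trans (++⁺ʳ [ m ] (↭-sym (shift 1 high middle))) high-first-↭

  high-first-above : PrefixAbove m k high-first
  high-first-above = subst (PrefixAbove m k) (sym (++-assoc high (1 ∷ middle) [ m ]))
    (subst (λ j → PrefixAbove m j (high ++ (1 ∷ middle) ∷ʳ m)) (length-applyUpTo _ k)
      (PrefixAbove-++ high _ (applyUpTo⁺₂ _ k (λ i → s≤s (m≤m+n m i)))))

  low-first-not-above : 1 ≤ k → ¬ PrefixAbove m k low-first
  low-first-not-above k≥1 above = <⇒≱ (head-above k≥1 above) (s≤s z≤n)

proposition2 : (n m : ℕ) → 1 ≤ n → 2 ≤ m → m ≤ n ∸ 1 →
    ¬ StronglyConnected n (Rprop2 n m) m
proposition2 n@(suc n') (suc (suc m')) (s≤s z≤n) (s≤s (s≤s z≤n)) m≤n' connected =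
  low-first-not-above k≥1
    (reachable-preserves-PrefixAbove k≥1
      (connected high-first low-first
        (node (high ++ 1 ∷ middle) high-first-↭) (node (1 ∷ high ++ middle) low-first-↭))
      high-first-above)
  where
  open Witnesses m' (n ∸ suc (suc m'))

  k≥1 : 1 ≤ n ∸ m
  k≥1 = m<n⇒0<n∸m (s≤s m≤n')

  node : ∀ ys → ys ∷ʳ m ↭ map suc (upTo (m + (n ∸ m))) → Node n m (ys ∷ʳ m)
  node ys π = subst (λ N → InΠ N (ys ∷ʳ m)) (m+[n∸m]≡n (m≤n⇒m≤1+n m≤n')) π , _ , m , refl , ≤-refl
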